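{- Let $C$ be a unimodular maximal cone in $\mathbb{R}^n$ with generators $v_1,\dots,v_n$. Then $C$ is tree-like if and only if $C$ is poset compatible and its second representing matrix $B_C$ has at most one nonzero entry in each column. Moreover, $\Psi$ restricted to tree-like cones is the inverse of $\Phi$: for a rooted forest $F$ with vertex set $\{1,\dots,n\}$, the order $\preceq_{\Phi(F)}$ (computed with generators $v_1(F),\dots,v_n(F)$) is the ancestor order of $F$, and for a tree-like cone $C$ one has $\Phi(\Psi(C))=C$. The same holds for decorated cones and decorated forests, with decorations carried along.
   Context: A maximal cone in $\mathbb{R}^n$ is $C=\mathbb{R}_{>0}v_1+\cdots+\mathbb{R}_{>0}v_n$ with $v_i=\sum_j a_{ij}e_j\in\mathbb{Z}^n$ linearly independent; $A_C=(a_{ij})$ is its representing matrix; $C$ is unimodular if all $a_{ij}\in\{0,1\}$. Define $i\preceq_C j$ iff $a_{ik}\ge a_{jk}$ for all $k$; this is a partial order on $\{1,\dots,n\}$, and $\Psi(C):=(\{1,\dots,n\},\preceq_C)$, viewed via its Hasse diagram. $C$ is poset compatible if $a_{ij}\ne0$ implies $i\preceq_C j$. The second representing matrix $B_C=(b_{ij})$ has $b_{ij}=1$ iff $j$ covers $i$ in $\preceq_C$ ($i\preceq_Cj$, $i\neq j$, no $k\notin\{i,j\}$ with $i\preceq_Ck\preceq_Cj$), and $b_{ij}=0$ otherwise. A rooted forest is a finite directed acyclic graph with no unoriented cycle, each connected component having a unique minimal element, ordered by $i\preceq j$ iff there is a directed path from $i$ to $j$. For a rooted forest $F$ with vertex set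 $\{1,\dots,n\}$, $\Phi(F)$ is the cone generated by $v_i(F)=\sum_{j:\,i\preceq j}e_j$. A cone is tree-like if it equals $\Phi(F)$ for some rooted forest $F$ (with a suitable labelling of its vertices by $\{1,\dots,n\}$). For decorations: $\overline\Phi(F,d)=(\Phi(F),(d(1),\dots,d(n)))$ and $\overline\Psi(C,\vec s)=(\Psi(C),i\mapsto s_i)$. -}

module Defs where

open import Level using (0ℓ)
open import Data.Nat using (ℕ; zero; suc)
open import Data.Integer using (ℤ; 0ℤ; 1ℤ; _+_; _*_; _≤_; _≤?_)
open import Data.Fin using (Fin; zero; suc; inject₁; fromℕ)
open import Data.Fin.Properties using (all?; any?) renaming (_≟_ to _≟F_)
open import Data.Product using (Σ; ∃; ∃-syntax; _×_; _,_; proj₁)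
open import Data.Product.Properties using ()
open import Data.Sum using (_⊎_)
open import Data.Bool using (if_then_else_)
open import Relation.Nullary using (¬_; Dec; yes; no)
open import Relation.Nullary.Decidable using (⌊_⌋; _×-dec_; ¬?)
open import Relation.Binary.PropositionalEquality using (_≡_; _≢_)
open import Relation.Binary.Construct.Closure.ReflexiveTransitive using (Star)
open import Function.Definitions using (Injective)

-- An n × n integer matrix; row i is the generator v_i = Σ_j a_ij e_j.
Matrix : ℕ → Set
Matrix n = Fin n → Fin n → ℤ

Σℤ : ∀ {n} → (Fin n → ℤ) → ℤ
Σℤ {zero}  f = 0ℤ
Σℤ {suc n} f = f zero + Σℤ (λ i → f (suc i))

-- The rows v_1..v_n are linearly independent (over ℤ, equivalently over ℚ or ℝ,
-- since the entries are integers): the cone is maximal.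
LinIndep : ∀ {n} → Matrix n → Set
LinIndep {n} A =
  (c : Fin n → ℤ) → (∀ k → Σℤ (λ i → c i * A i k) ≡ 0ℤ) → ∀ i → c i ≡ 0ℤ

Unimodular : ∀ {n} → Matrix n → Set
Unimodular A = ∀ i j → (A i j ≡ 0ℤ) ⊎ (A i j ≡ 1ℤ)

_≼[_]_ : ∀ {n} → Fin n → Matrix n → Fin n → Set
i ≼[ A ] j = ∀ k → A j k ≤ A i k

≼? : ∀ {n} (A : Matrix n) (i j : Fin n) → Dec (i ≼[ A ] j)
≼? A i j = all? (λ k → A j k ≤? A i k)

PosetCompatible : ∀ {n} → Matrix n → Set
PosetCompatible A = ∀ i j → A i j ≢ 0ℤ → i ≼[ A ] j

Covers : ∀ {n} → Matrix n → Fin n → Fin n → Set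
Covers A i j =
  i ≼[ A ] j × i ≢ j ×
  ¬ (∃[ k ] (k ≢ i × k ≢ j × i ≼[ A ] k × k ≼[ A ] j))

Covers? : ∀ {n} (A : Matrix n) (i j : Fin n) → Dec (Covers A i j)
Covers? A i j =
  ≼? A i j ×-dec ¬? (i ≟F j) ×-dec
  ¬? (any? (λ k → ¬? (k ≟F i) ×-dec ¬? (k ≟F j) ×-dec ≼? A i k ×-dec ≼? A k j))

B : ∀ {n} → Matrix n → Matrix n
B A i j = if ⌊ Covers? A i j ⌋ then 1ℤ else 0ℤ

ColumnsAtMostOneNonzero : ∀ {n} → Matrix n → Set
ColumnsAtMostOneNonzero M = ∀ j i i' → M i j ≢ 0ℤ → M i' j ≢ 0ℤ → i ≡ i'

Graph : ℕ → Set₁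
Graph n = Fin n → Fin n → Set

Path : ∀ {n} → Graph n → Fin n → Fin n → Set
Path E = Star E

Adj : ∀ {n} → Graph n → Fin n → Fin n → Set
Adj E x y = E x y ⊎ E y x

Acyclic : ∀ {n} → Graph n → Set
Acyclic E = ∀ i j → E i j → ¬ Path E j i

-- an unoriented cycle: distinct vertices c_0,…,c_{m-1} (m = k+3 ≥ 3) with
-- c_t, c_{t+1} adjacent for all t and c_{m-1}, c_0 adjacent.
-- (cycles of length ≤ 2 are loops or antiparallel edges, i.e. directed cycles.)
UnorientedCycle : ∀ {n} → Graph n → Set
UnorientedCycle {n} E =
  ∃[ k ] Σ (Fin (suc (suc (suc k))) → Fin n) λ c →
    Injective _≡_ _≡_ c ×
    (∀ (t : Fin (suc (suc k))) → Adj E (c (inject₁ t)) (c (suc t))) ×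
    Adj E (c (fromℕ (suc (suc k)))) (c zero)

Connected : ∀ {n} → Graph n → Fin n → Fin n → Set
Connected E = Star (Adj E)

Minimal : ∀ {n} → Graph n → Fin n → Set
Minimal E m = ¬ (∃[ y ] (y ≢ m × Path E y m))

UniqueRoots : ∀ {n} → Graph n → Set
UniqueRoots E =
  ∀ x → ∃[ m ] (Connected E x m × Minimal E m ×
                 (∀ m' → Connected E x m' → Minimal E m' → m' ≡ m))

IsRootedForest : ∀ {n} → Graph n → Set
IsRootedForest E = Acyclic E × ¬ UnorientedCycle E × UniqueRoots E

record RootedForest (n : ℕ) : Set₁ where
  field
    E        : Graph n
    isForest : IsRootedForest E
open RootedForest public

-- Φ: A is the representing matrix of Φ(E), i.e. row i is v_i = Σ_{j : i ≼ j} e_j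
IsΦ : ∀ {n} → Graph n → Matrix n → Set
IsΦ E A = ∀ i j → (Path E i j × A i j ≡ 1ℤ) ⊎ (¬ Path E i j × A i j ≡ 0ℤ)

-- tree-like: C = Φ(F) for some rooted forest F on {1..n} (any labelling)
TreeLike : ∀ {n} → Matrix n → Set₁
TreeLike {n} A = Σ (RootedForest n) λ F → IsΦ (E F) A

-- Ψ(C), viewed via its Hasse diagram: edges i → j iff j covers i
HasseΨ : ∀ {n} → Matrix n → Graph n
HasseΨ A = Covers A

IsΦ̄ : ∀ {n} {S : Set} → Graph n → (Fin n → S) → Matrix n → (Fin n → S) → Set
IsΦ̄ E d A s = IsΦ E A × (∀ i → s i ≡ d i)

Ψ̄ : ∀ {n} {S : Set} → Matrix n → (Fin n → S) → Graph n × (Fin n → S)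
Ψ̄ A s = HasseΨ A , s

{-# OPTIONS --safe #-}
module Submission where

-- For a unimodular matrix, i ≼ j says that the support of row j lies in the support of row i;
-- with independent rows ≼ is a partial order along which the number of ones strictly decreases
-- and the number of zeros strictly increases, and these counts drive every descent argument.
-- If A = Φ(F), the support of row i is the set of descendants of i, so ≼ is the ancestor order of F
-- and the covering pairs are the edges of F. A rooted forest has at most one parent per vertex,
-- which is the column condition on B_A, and poset compatibility is immediate.
-- Conversely, under the two conditions the Hasse diagram of ≼ has at most one parent per vertex,
-- hence is a rooted forest, and A = Φ(Hasse diagram) as soon as every diagonal entry is 1,
-- which independence forces.

open import Defs
open import Level using (_⊔_)
open import Data.Nat as ℕ using (ℕ; zero; suc; _∸_; z≤n; s≤s)
import Data.Nat.Properties as ℕ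
open import Data.Nat.Induction using (<-wellFounded)
open import Data.Integer using (ℤ; 0ℤ; 1ℤ; -1ℤ; _+_; _-_; _*_; _≤_; +≤+; ∣_∣)
import Data.Integer.Properties as ℤ
open import Data.Fin using (Fin; zero; suc; inject₁; fromℕ)
open import Data.Fin.Properties using (any?; all?; ¬∀⟶∃¬; suc-injective) renaming (_≟_ to _≟F_)
open import Data.List using (List; []; _∷_; _++_; lookup; length)
open import Data.List.Membership.Propositional using (_∈_; _∉_)
open import Data.List.Membership.Propositional.Properties using (∈-++⁻; ∈-lookup)
import Data.List.Relation.Unary.All as All
open import Data.List.Relation.Unary.Any using (here; there)
open import Data.List.Relation.Unary.All.Properties using (¬Any⇒All¬)
open import Data.List.Relation.Unary.Unique.Propositional using (Unique; []; _∷_)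
import Data.List.Relation.Unary.Unique.Propositional.Properties as Unique
open import Data.List.Relation.Unary.Unique.Propositional.Properties using (Unique[x∷xs]⇒x∉xs)
import Data.List.Relation.Unary.AllPairs as AllPairs
open import Data.List.Relation.Binary.Disjoint.Propositional using (Disjoint)
open import Data.Product using (∃-syntax; _×_; _,_; proj₁; proj₂; uncurry)
open import Data.Sum using (_⊎_; inj₁; inj₂)
open import Data.Empty using (⊥; ⊥-elim)
open import Function using (_∘_; id; flip)
open import Function.Definitions using (Injective)
open import Induction.WellFounded using (Acc; acc)
open import Relation.Nullary using (¬_; Dec; yes; no; contradiction)
open import Relation.Nullary.Decidable using (_×-dec_; _→-dec_; ¬?; map′)
open import Relation.Unary using (Pred; Decidable)
open import Relation.Binary using (Rel)
open import Relation.Binary.PropositionalEquality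
  using (_≡_; _≢_; refl; sym; trans; cong; cong₂; subst; subst₂; module ≡-Reasoning)
open import Relation.Binary.Construct.Closure.ReflexiveTransitive using (Star; ε; _◅_; _◅◅_; reverse)
import Relation.Binary.Construct.Closure.ReflexiveTransitive as Star

Σℕ : ∀ {n} → (Fin n → ℕ) → ℕ
Σℕ {zero}  f = 0
Σℕ {suc n} f = f zero ℕ.+ Σℕ (f ∘ suc)

Σℕ-mono-≤ : ∀ {n} {f g : Fin n → ℕ} → (∀ k → f k ℕ.≤ g k) → Σℕ f ℕ.≤ Σℕ g
Σℕ-mono-≤ {zero}  f≤g = z≤n
Σℕ-mono-≤ {suc n} {f} {g} f≤g =
  ℕ.+-mono-≤ (f≤g zero) (Σℕ-mono-≤ {f = f ∘ suc} {g ∘ suc} (f≤g ∘ suc))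

Σℕ-mono-< : ∀ {n} {f g : Fin n → ℕ} → (∀ k → f k ℕ.≤ g k) → ∀ k → f k ℕ.< g k → Σℕ f ℕ.< Σℕ g
Σℕ-mono-< {suc n} {f} {g} f≤g zero    f<g =
  ℕ.+-mono-<-≤ f<g (Σℕ-mono-≤ {f = f ∘ suc} {g ∘ suc} (f≤g ∘ suc))
Σℕ-mono-< {suc n} {f} {g} f≤g (suc k) f<g =
  ℕ.+-mono-≤-< (f≤g zero) (Σℕ-mono-< {f = f ∘ suc} {g ∘ suc} (f≤g ∘ suc) k f<g)

Σℤ-zero : ∀ {n} {f : Fin n → ℤ} → (∀ l → f l ≡ 0ℤ) → Σℤ f ≡ 0ℤ
Σℤ-zero {zero}  f≡0 = refl
Σℤ-zero {suc n} {f} f≡0 = cong₂ _+_ (f≡0 zero) (Σℤ-zero {f = f ∘ suc} (f≡0 ∘ suc))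

Σℤ-single : ∀ {n} {f : Fin n → ℤ} i → (∀ l → l ≢ i → f l ≡ 0ℤ) → Σℤ f ≡ f i
Σℤ-single {f = f} zero f≡0 =
  trans (cong (f zero +_) (Σℤ-zero {f = f ∘ suc} (λ l → f≡0 (suc l) λ ()))) (ℤ.+-identityʳ (f zero))
Σℤ-single {f = f} (suc i) f≡0 =
  trans (cong (_+ Σℤ (f ∘ suc)) (f≡0 zero (λ ())))
        (trans (ℤ.+-identityˡ _)
               (Σℤ-single {f = f ∘ suc} i (λ l l≢i → f≡0 (suc l) (l≢i ∘ suc-injective))))

Σℤ-pair : ∀ {n} {f : Fin n → ℤ} i j → i ≢ j → (∀ l → l ≢ i → l ≢ j → f l ≡ 0ℤ) →
          Σℤ f ≡ f i + f j
Σℤ-pair zero    zero    i≢j f≡0 = contradiction refl i≢j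
Σℤ-pair {f = f} zero (suc j) i≢j f≡0 =
  cong (f zero +_) (Σℤ-single {f = f ∘ suc} j (λ l l≢j → f≡0 (suc l) (λ ()) (l≢j ∘ suc-injective)))
Σℤ-pair {f = f} (suc i) zero i≢j f≡0 =
  trans (cong (f zero +_)
              (Σℤ-single {f = f ∘ suc} i (λ l l≢i → f≡0 (suc l) (l≢i ∘ suc-injective) (λ ()))))
        (ℤ.+-comm (f zero) (f (suc i)))
Σℤ-pair {f = f} (suc i) (suc j) i≢j f≡0 =
  trans (cong (_+ Σℤ (f ∘ suc)) (f≡0 zero (λ ()) (λ ())))
        (trans (ℤ.+-identityˡ _)
               (Σℤ-pair {f = f ∘ suc} i j (i≢j ∘ cong suc)
                        (λ l l≢i l≢j → f≡0 (suc l) (l≢i ∘ suc-injective) (l≢j ∘ suc-injective))))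

module _ {n p} {P : Pred (Fin n) p} (P? : Decidable P) (μ : Fin n → ℕ) where

  minimiser : ∀ {x} → P x → ∃[ m ] (P m × ∀ {y} → P y → μ m ℕ.≤ μ y)
  minimiser {x} = go x (<-wellFounded (μ x))
    where
    go : ∀ x → Acc ℕ._<_ (μ x) → P x → ∃[ m ] (P m × ∀ {y} → P y → μ m ℕ.≤ μ y)
    go x (acc smaller) Px with any? (λ y → P? y ×-dec μ y ℕ.<? μ x)
    ... | yes (y , Py , y<x) = go y (smaller y<x) Py
    ... | no  ¬lower         = x , Px , λ Py → ℕ.≮⇒≥ (λ y<x → ¬lower (_ , Py , y<x))

module _ {a ℓ} {V : Set a} {R : Rel V ℓ} where

  backwards : ∀ {x y} → Star R x y → Star (flip R) y x
  backwards = reverse id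

  forwards : ∀ {x y} → Star (flip R) y x → Star R x y
  forwards = reverse id

  targets : ∀ {x y} → Star R x y → List V
  targets ε                 = []
  targets (_◅_ {j = y} _ p) = y ∷ targets p

  vertices : ∀ {x y} → Star R x y → List V
  vertices {x} p = x ∷ targets p

  targets-◅◅ : ∀ {x y z} (p : Star R x y) (q : Star R y z) → targets (p ◅◅ q) ≡ targets p ++ targets q
  targets-◅◅ ε       q = refl
  targets-◅◅ (e ◅ p) q = cong (_ ∷_) (targets-◅◅ p q)

  ∈-vertices : ∀ {x y z} (p : Star R x y) → z ∈ vertices p → Star R x z × Star R z y
  ∈-vertices p       (here refl) = ε , p
  ∈-vertices (e ◅ p) (there z∈)  with ∈-vertices p z∈
  ... | y→z , z→ = e ◅ y→z , z→

  vertices-unique : (∀ {x y} → R x y → ¬ Star R y x) → ∀ {x y} (p : Star R x y) → Unique (vertices p)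
  vertices-unique acyclic ε       = All.[] ∷ []
  vertices-unique acyclic (e ◅ p) =
    ¬Any⇒All¬ _ (λ x∈ → acyclic e (proj₁ (∈-vertices p x∈))) ∷ vertices-unique acyclic p

  vertex-link : ∀ {x y} (p : Star R x y) (t : Fin (length (targets p))) →
                R (lookup (vertices p) (inject₁ t)) (lookup (vertices p) (suc t))
  vertex-link (e ◅ p) zero    = e
  vertex-link (e ◅ p) (suc t) = vertex-link p t

  vertex-last : ∀ {x y} (p : Star R x y) → lookup (vertices p) (fromℕ (length (targets p))) ≡ y
  vertex-last ε       = refl
  vertex-last (e ◅ p) = vertex-last p

targets-map : ∀ {a ℓ ℓ′} {V : Set a} {R : Rel V ℓ} {S : Rel V ℓ′} (f : ∀ {x y} → R x y → S x y)
              {x y} (p : Star R x y) → targets (Star.map f p) ≡ targets p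
targets-map f ε       = refl
targets-map f (e ◅ p) = cong (_ ∷_) (targets-map f p)

lookup-injective : ∀ {a} {V : Set a} {xs : List V} → Unique xs → Injective _≡_ _≡_ (lookup xs)
lookup-injective (x∉ ∷ unique) {zero}  {zero}  _  = refl
lookup-injective (x∉ ∷ unique) {zero}  {suc t} eq = contradiction eq (All.lookup x∉ (∈-lookup t))
lookup-injective (x∉ ∷ unique) {suc s} {zero}  eq = contradiction (sym eq) (All.lookup x∉ (∈-lookup s))
lookup-injective (x∉ ∷ unique) {suc s} {suc t} eq = cong suc (lookup-injective unique eq)

AtMostOneParent : ∀ {a ℓ} {V : Set a} → Rel V ℓ → Set (a ⊔ ℓ)
AtMostOneParent R = ∀ {x y z} → R x z → R y z → x ≡ y

ancestors-comparable : ∀ {a ℓ} {V : Set a} {R : Rel V ℓ} → AtMostOneParent R →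
                       ∀ {x y z} → Star R x z → Star R y z → Star R x y ⊎ Star R y x
ancestors-comparable {R = R} one-parent {x} {y} p q = compare (backwards p) (backwards q)
  where
  compare : ∀ {z} → Star (flip R) z x → Star (flip R) z y → Star R x y ⊎ Star R y x
  compare ε        q        = inj₂ (forwards q)
  compare (e ◅ p)  ε        = inj₁ (forwards (e ◅ p))
  compare (e ◅ p)  (e′ ◅ q) with one-parent e e′
  ... | refl = compare p q

Walk : ∀ {a ℓ} {V : Set a} → Rel V ℓ → ∀ {m} → (Fin (suc m) → V) → Set ℓ
Walk R {m} c = ∀ (t : Fin m) → R (c (inject₁ t)) (c (suc t))

walk⇒star : ∀ {a ℓ} {V : Set a} {R : Rel V ℓ} {m} {c : Fin (suc m) → V} →
            Walk R c → Star R (c zero) (c (fromℕ m))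
walk⇒star {m = zero}          w = ε
walk⇒star {m = suc m} {c = c} w = w zero ◅ walk⇒star {c = c ∘ suc} (w ∘ suc)

module _ {n} {G : Graph n} (one-parent : AtMostOneParent G) where

  forward-walk : ∀ {m} {c : Fin (suc (suc m)) → Fin n} → Injective _≡_ _≡_ c →
                 Walk (Adj G) c → G (c zero) (c (suc zero)) → Walk G c
  forward-walk                     inj w e zero    = e
  forward-walk {m = zero}          inj w e (suc ())
  forward-walk {m = suc m} {c = c} inj w e (suc t) with w (suc zero)
  ... | inj₁ e′ = forward-walk {c = c ∘ suc} (suc-injective ∘ inj) (w ∘ suc) e′ t
  ... | inj₂ e′ with inj (one-parent e e′)
  ...   | ()

  backward-walk : ∀ {m} {c : Fin (suc (suc m)) → Fin n} → Injective _≡_ _≡_ c →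
                  Walk (Adj G) c → G (c (fromℕ (suc m))) (c (inject₁ (fromℕ m))) → Walk (flip G) c
  backward-walk {m = zero}          inj w e zero = e
  backward-walk {m = suc m} {c = c} inj w e      = go
    where
    later : Walk (flip G) (c ∘ suc)
    later = backward-walk {c = c ∘ suc} (suc-injective ∘ inj) (w ∘ suc) e
    go : Walk (flip G) c
    go (suc t) = later t
    go zero with w zero
    ... | inj₂ e′ = e′
    ... | inj₁ e′ with inj (one-parent e′ (later zero))
    ...   | ()

  -- The orientation of the edges propagates along an injective walk, so an unoriented cycle is directed.
  no-unoriented-cycle : Acyclic G → ¬ UnorientedCycle G
  no-unoriented-cycle acyclic (k , c , inj , w , inj₁ closing) with w zero
  ... | inj₁ e = acyclic _ _ closing (walk⇒star {c = c} (forward-walk {c = c} inj w e))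
  ... | inj₂ e with inj (one-parent closing e)
  ...   | ()
  no-unoriented-cycle acyclic (k , c , inj , w , inj₂ closing) with w (fromℕ (suc k))
  ... | inj₂ e = acyclic _ _ closing (forwards (walk⇒star {c = c} (backward-walk {c = c} inj w e)))
  ... | inj₁ e with inj (one-parent closing e)
  ...   | ()

closed-walk⇒cycle : ∀ {n} {G : Graph n} {x y z} (e : Adj G x y) (p : Star (Adj G) y z) → y ≢ z →
                    Unique (vertices (e ◅ p)) → Adj G z x → UnorientedCycle G
closed-walk⇒cycle e ε        y≢z = contradiction refl y≢z
closed-walk⇒cycle {G = G} e (e′ ◅ p) _ unique closing =
  length (targets p) , lookup (vertices w) , lookup-injective unique , vertex-link w ,
  subst (λ v → Adj G v _) (sym (vertex-last w)) closing
  where w = e ◅ e′ ◅ p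

module _ {n} {G : Graph n} where

  minimal-ancestor : (∀ x y → Dec (Path G x y)) → (μ : Fin n → ℕ) →
                     (∀ {x y} → Path G x y → x ≢ y → μ x ℕ.< μ y) →
                     ∀ x → ∃[ r ] (Path G r x × Minimal G r)
  minimal-ancestor path? μ μ-mono x with minimiser (λ r → path? r x) μ ε
  ... | r , r→x , least =
    r , r→x , λ (y , y≢r , y→r) → ℕ.<⇒≱ (μ-mono y→r y≢r) (least (y→r ◅◅ r→x))

  minimal-ancestors-unique : AtMostOneParent G → ∀ {r r′ x} → Path G r x → Minimal G r →
                             Path G r′ x → Minimal G r′ → r ≡ r′
  minimal-ancestors-unique one-parent {r} {r′} r→x min r′→x min′ with r ≟F r′
  ... | yes r≡r′ = r≡r′
  ... | no  r≢r′ with ancestors-comparable one-parent r→x r′→x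
  ...   | inj₁ r→r′ = contradiction (r , r≢r′ , r→r′) min′
  ...   | inj₂ r′→r = contradiction (r′ , r≢r′ ∘ sym , r′→r) min

  module _ (one-parent : AtMostOneParent G) (root : ∀ x → ∃[ r ] (Path G r x × Minimal G r)) where

    root-constant : ∀ {x y} → Connected G x y → proj₁ (root x) ≡ proj₁ (root y)
    root-constant ε = refl
    root-constant {x} (_◅_ {j = y} x~y y~z) = trans (same-root x~y) (root-constant y~z)
      where
      same-root : Adj G x y → proj₁ (root x) ≡ proj₁ (root y)
      same-root (inj₁ x→y) with root x | root y
      ... | rx , rx→x , min-x | ry , ry→y , min-y =
        minimal-ancestors-unique one-parent (rx→x ◅◅ (x→y ◅ ε)) min-x ry→y min-y
      same-root (inj₂ y→x) with root x | root y
      ... | rx , rx→x , min-x | ry , ry→y , min-y =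
        minimal-ancestors-unique one-parent rx→x min-x (ry→y ◅◅ (y→x ◅ ε)) min-y

    own-root : ∀ {m} → Minimal G m → proj₁ (root m) ≡ m
    own-root {m} min with root m
    ... | r , r→m , min-r = minimal-ancestors-unique one-parent r→m min-r ε min

    unique-roots : UniqueRoots G
    unique-roots x with root x | root-constant {x}
    ... | r , r→x , min | same-root =
      r , reverse inj₂ r→x , min , λ m x~m min-m → sym (trans (same-root x~m) (own-root min-m))

1≢0 : 1ℤ ≢ 0ℤ
1≢0 ()

1≰0 : ¬ (1ℤ ≤ 0ℤ)
1≰0 (+≤+ ())

signed : ∀ {p q} {P : Set p} {Q : Set q} → Dec P → Dec Q → ℤ
signed (yes _) _       = 1ℤ
signed (no _)  (yes _) = -1ℤ
signed (no _)  (no _)  = 0ℤ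

module _ {p q} {P : Set p} {Q : Set q} where

  signed-yes : (P? : Dec P) (Q? : Dec Q) → P → signed P? Q? ≡ 1ℤ
  signed-yes (yes _) _ _  = refl
  signed-yes (no ¬P) _ pf = contradiction pf ¬P

  signed-no-yes : (P? : Dec P) (Q? : Dec Q) → ¬ P → Q → signed P? Q? ≡ -1ℤ
  signed-no-yes (yes pf) _        ¬P _  = contradiction pf ¬P
  signed-no-yes (no _)   (yes _)  _  _  = refl
  signed-no-yes (no _)   (no ¬Q)  _  qf = contradiction qf ¬Q

  signed-no-no : (P? : Dec P) (Q? : Dec Q) → ¬ P → ¬ Q → signed P? Q? ≡ 0ℤ
  signed-no-no (yes pf) _        ¬P _  = contradiction pf ¬P
  signed-no-no (no _)   (yes qf) _  ¬Q = contradiction qf ¬Q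
  signed-no-no (no _)   (no _)   _  _  = refl

module _ {n} {A : Matrix n} where

  ≼-refl : ∀ {i} → i ≼[ A ] i
  ≼-refl k = ℤ.≤-refl

  ≼-trans : ∀ {i j k} → i ≼[ A ] j → j ≼[ A ] k → i ≼[ A ] k
  ≼-trans i≼j j≼k l = ℤ.≤-trans (j≼k l) (i≼j l)

  covers*⇒≼ : ∀ {i j} → Star (Covers A) i j → i ≼[ A ] j
  covers*⇒≼ ε             = ≼-refl
  covers*⇒≼ (i⋖k ◅ k⋖*j) = ≼-trans (proj₁ i⋖k) (covers*⇒≼ k⋖*j)

  B≢0⇒covers : ∀ {i j} → B A i j ≢ 0ℤ → Covers A i j
  B≢0⇒covers {i} {j} B≢0 with Covers? A i j
  ... | yes i⋖j = i⋖j
  ... | no  _   = contradiction refl B≢0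

  covers⇒B≢0 : ∀ {i j} → Covers A i j → B A i j ≢ 0ℤ
  covers⇒B≢0 {i} {j} i⋖j with Covers? A i j
  ... | yes _   = 1≢0
  ... | no  i⋪j = contradiction i⋖j i⋪j

  independent⇒rows-distinct : LinIndep A → ∀ {i j} → i ≢ j → ¬ (∀ k → A i k ≡ A j k)
  independent⇒rows-distinct independent {i} {j} i≢j same =
    1≢0 (trans (sym (signed-yes (i ≟F i) (i ≟F j) refl)) (independent c dependence i))
    where
    c : Fin n → ℤ
    c l = signed (l ≟F i) (l ≟F j)
    dependence : ∀ k → Σℤ (λ l → c l * A l k) ≡ 0ℤ
    dependence k = begin
      Σℤ (λ l → c l * A l k)
        ≡⟨ Σℤ-pair i j i≢j (λ l l≢i l≢j → cong (_* A l k) (signed-no-no (l ≟F i) (l ≟F j) l≢i l≢j)) ⟩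
      c i * A i k + c j * A j k
        ≡⟨ cong₂ _+_ (cong (_* A i k) (signed-yes (i ≟F i) (i ≟F j) refl))
                     (cong (_* A j k) (signed-no-yes (j ≟F i) (j ≟F j) (i≢j ∘ sym) refl)) ⟩
      1ℤ * A i k + -1ℤ * A j k
        ≡⟨ cong₂ _+_ (ℤ.*-identityˡ (A i k)) (ℤ.-1*i≡-i (A j k)) ⟩
      A i k - A j k
        ≡⟨ cong (_- A j k) (same k) ⟩
      A j k - A j k
        ≡⟨ ℤ.+-inverseʳ (A j k) ⟩
      0ℤ ∎
      where open ≡-Reasoning

module UnimodularCone {n} {A : Matrix n} (unimodular : Unimodular A) where

  ≼⇒ones-⊆ : ∀ {i j k} → i ≼[ A ] j → A j k ≡ 1ℤ → A i k ≡ 1ℤ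
  ≼⇒ones-⊆ {i} {j} {k} i≼j Ajk≡1 with unimodular i k
  ... | inj₂ Aik≡1 = Aik≡1
  ... | inj₁ Aik≡0 = contradiction (subst₂ _≤_ Ajk≡1 Aik≡0 (i≼j k)) 1≰0

  ones-⊆⇒≼ : ∀ {i j} → (∀ k → A j k ≡ 1ℤ → A i k ≡ 1ℤ) → i ≼[ A ] j
  ones-⊆⇒≼ {i} {j} ones-⊆ k with unimodular j k | unimodular i k
  ... | inj₂ Ajk≡1 | _          = subst₂ _≤_ (sym Ajk≡1) (sym (ones-⊆ k Ajk≡1)) ℤ.≤-refl
  ... | inj₁ Ajk≡0 | inj₁ Aik≡0 = subst₂ _≤_ (sym Ajk≡0) (sym Aik≡0) ℤ.≤-refl
  ... | inj₁ Ajk≡0 | inj₂ Aik≡1 = subst₂ _≤_ (sym Ajk≡0) (sym Aik≡1) (+≤+ z≤n)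

  column-step : ∀ {i j} → i ≼[ A ] j → ∀ k → A j k ≡ A i k ⊎ (A j k ≡ 0ℤ × A i k ≡ 1ℤ)
  column-step {i} {j} i≼j k with unimodular j k
  ... | inj₂ Ajk≡1 = inj₁ (trans Ajk≡1 (sym (≼⇒ones-⊆ i≼j Ajk≡1)))
  ... | inj₁ Ajk≡0 with unimodular i k
  ...   | inj₁ Aik≡0 = inj₁ (trans Ajk≡0 (sym Aik≡0))
  ...   | inj₂ Aik≡1 = inj₂ (Ajk≡0 , Aik≡1)

  ones zeros : Fin n → ℕ
  ones  i = Σℕ (λ k → ∣ A i k ∣)
  zeros i = Σℕ (λ k → 1 ∸ ∣ A i k ∣)

  private
    weights-≤ : ∀ {x y} → x ≡ y ⊎ (x ≡ 0ℤ × y ≡ 1ℤ) → ∣ x ∣ ℕ.≤ ∣ y ∣ × 1 ∸ ∣ y ∣ ℕ.≤ 1 ∸ ∣ x ∣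
    weights-≤ (inj₁ refl)          = ℕ.≤-refl , ℕ.≤-refl
    weights-≤ (inj₂ (refl , refl)) = z≤n , z≤n

    weights-< : ∀ {x y} → x ≡ 0ℤ → y ≡ 1ℤ → ∣ x ∣ ℕ.< ∣ y ∣ × 1 ∸ ∣ y ∣ ℕ.< 1 ∸ ∣ x ∣
    weights-< refl refl = s≤s z≤n , s≤s z≤n

  module _ (independent : LinIndep A) where

    ≼-antisym : ∀ {i j} → i ≼[ A ] j → j ≼[ A ] i → i ≡ j
    ≼-antisym {i} {j} i≼j j≼i with i ≟F j
    ... | yes i≡j = i≡j
    ... | no  i≢j =
      contradiction (λ k → ℤ.≤-antisym (j≼i k) (i≼j k)) (independent⇒rows-distinct independent i≢j)

    private
      ≺⇒weights-< : ∀ {i j} → i ≼[ A ] j → i ≢ j → ones j ℕ.< ones i × zeros i ℕ.< zeros j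
      ≺⇒weights-< {i} {j} i≼j i≢j
        with ¬∀⟶∃¬ n _ (λ k → A i k ℤ.≟ A j k) (independent⇒rows-distinct independent i≢j)
      ... | k , Aik≢Ajk with column-step i≼j k
      ...   | inj₁ Ajk≡Aik          = contradiction (sym Ajk≡Aik) Aik≢Ajk
      ...   | inj₂ (Ajk≡0 , Aik≡1) =
        Σℕ-mono-< (proj₁ ∘ weights-≤ ∘ column-step i≼j) k (proj₁ (weights-< Ajk≡0 Aik≡1)) ,
        Σℕ-mono-< (proj₂ ∘ weights-≤ ∘ column-step i≼j) k (proj₂ (weights-< Ajk≡0 Aik≡1))

    ≺⇒ones-< : ∀ {i j} → i ≼[ A ] j → i ≢ j → ones j ℕ.< ones i
    ≺⇒ones-< i≼j i≢j = proj₁ (≺⇒weights-< i≼j i≢j)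

    ≺⇒zeros-< : ∀ {i j} → i ≼[ A ] j → i ≢ j → zeros i ℕ.< zeros j
    ≺⇒zeros-< i≼j i≢j = proj₂ (≺⇒weights-< i≼j i≢j)

    ≼⇒covers* : ∀ {i j} → i ≼[ A ] j → Star (Covers A) i j
    ≼⇒covers* {i} {j} = go i (<-wellFounded (ones i))
      where
      go : ∀ i → Acc ℕ._<_ (ones i) → i ≼[ A ] j → Star (Covers A) i j
      go i (acc smaller) i≼j with i ≟F j
      ... | yes refl = ε
      ... | no  i≢j
        with minimiser (λ k → ¬? (k ≟F i) ×-dec ≼? A i k ×-dec ≼? A k j) zeros
                       (i≢j ∘ sym , i≼j , ≼-refl {A = A})
      ...   | k , (k≢i , i≼k , k≼j) , least =
        (i≼k , k≢i ∘ sym , no-middle) ◅ go k (smaller (≺⇒ones-< i≼k (k≢i ∘ sym))) k≼j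
        where
        no-middle : ¬ (∃[ m ] (m ≢ i × m ≢ k × i ≼[ A ] m × m ≼[ A ] k))
        no-middle (m , m≢i , m≢k , i≼m , m≼k) =
          ℕ.<⇒≱ (≺⇒zeros-< m≼k m≢k) (least (m≢i , i≼m , ≼-trans {A = A} m≼k k≼j))

module Φ-order {n} {G : Graph n} {A : Matrix n} (Φ : IsΦ G A) where

  Path⇒one : ∀ {i j} → Path G i j → A i j ≡ 1ℤ
  Path⇒one {i} {j} i→j with Φ i j
  ... | inj₁ (_ , Aij≡1) = Aij≡1
  ... | inj₂ (¬i→j , _) = contradiction i→j ¬i→j

  one⇒Path : ∀ {i j} → A i j ≡ 1ℤ → Path G i j
  one⇒Path {i} {j} Aij≡1 with Φ i j
  ... | inj₁ (i→j , _)    = i→j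
  ... | inj₂ (_ , Aij≡0) = contradiction (trans (sym Aij≡1) Aij≡0) 1≢0

  unimodular : Unimodular A
  unimodular i j with Φ i j
  ... | inj₁ (_ , Aij≡1) = inj₂ Aij≡1
  ... | inj₂ (_ , Aij≡0) = inj₁ Aij≡0

  open UnimodularCone unimodular

  Path⇒≼ : ∀ {i j} → Path G i j → i ≼[ A ] j
  Path⇒≼ i→j = ones-⊆⇒≼ (λ k Ajk≡1 → Path⇒one (i→j ◅◅ one⇒Path Ajk≡1))

  ≼⇒Path : ∀ {i j} → i ≼[ A ] j → Path G i j
  ≼⇒Path i≼j = one⇒Path (≼⇒ones-⊆ i≼j (Path⇒one ε))

  ≼⇔Path : ∀ i j → (i ≼[ A ] j → Path G i j) × (Path G i j → i ≼[ A ] j)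
  ≼⇔Path i j = ≼⇒Path , Path⇒≼

  Path? : ∀ i j → Dec (Path G i j)
  Path? i j = map′ one⇒Path Path⇒one (A i j ℤ.≟ 1ℤ)

  module _ (independent : LinIndep A) where

    root : ∀ x → ∃[ r ] (Path G r x × Minimal G r)
    root = minimal-ancestor Path? zeros (λ x→y → ≺⇒zeros-< independent (Path⇒≼ x→y))

    rooted-forest : Acyclic G → AtMostOneParent G → IsRootedForest G
    rooted-forest acyclic one-parent =
      acyclic , no-unoriented-cycle one-parent acyclic , unique-roots one-parent root

module TreeLikeCone {n} (F : RootedForest n) {A : Matrix n} (Φ : IsΦ (E F) A)
                    (independent : LinIndep A) where

  open Φ-order Φ
  open UnimodularCone unimodular

  private
    G : Graph n
    G = E F

  acyclic : Acyclic G
  acyclic = proj₁ (isForest F)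

  loop-free : ∀ {i j} → G i j → i ≢ j
  loop-free i→j refl = acyclic _ _ i→j ε

  common-ancestor : ∀ {a b j} → G a j → G b j → ∃[ r ] (Path G r a × Path G r b)
  common-ancestor {a} {b} {j} a→j b→j
    with root independent a | root independent b | proj₂ (proj₂ (isForest F)) j
  ... | ra , ra→a , min-a | rb , rb→b , min-b | _ , _ , _ , unique =
    rb , subst (λ r → Path G r a) ra≡rb ra→a , rb→b
    where
    j~ : ∀ {x r} → G x j → Path G r x → Connected G j r
    j~ x→j r→x = inj₂ x→j ◅ reverse inj₂ r→x
    ra≡rb : ra ≡ rb
    ra≡rb = trans (unique ra (j~ a→j ra→a) min-a) (sym (unique rb (j~ b→j rb→b) min-b))

  -- Two parents a ≢ b of j and a deepest common ancestor u of a and b span the unoriented cycle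
  -- j, a, …, u, …, b: a common vertex of the paths u ⇝ a and u ⇝ b other than u would be deeper.
  one-parent : AtMostOneParent G
  one-parent {a} {b} {j} a→j b→j with a ≟F b
  ... | yes a≡b = a≡b
  ... | no  a≢b with common-ancestor a→j b→j
  ...   | r , r→a , r→b with minimiser (λ v → Path? v a ×-dec Path? v b) ones (r→a , r→b)
  ...     | u , (u→a , u→b) , deepest =
    contradiction (closed-walk⇒cycle (inj₂ a→j) walk a≢b simple (inj₁ b→j)) (proj₁ (proj₂ (isForest F)))
    where
    up : Star (flip G) a u
    up = backwards u→a
    walk : Star (Adj G) a b
    walk = Star.map inj₂ up ◅◅ Star.map inj₁ u→b
    walk-targets : targets walk ≡ targets up ++ targets u→b
    walk-targets = trans (targets-◅◅ (Star.map inj₂ up) (Star.map inj₁ u→b))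
                         (cong₂ _++_ (targets-map inj₂ up) (targets-map inj₁ u→b))
    down-unique : Unique (vertices u→b)
    down-unique = vertices-unique (acyclic _ _) u→b
    disjoint : Disjoint (vertices up) (targets u→b)
    disjoint {z} (z∈up , z∈down) with ∈-vertices up z∈up | ∈-vertices u→b (there z∈down)
    ... | a⇠z , _ | u→z , z→b =
      ℕ.<⇒≱ (≺⇒ones-< independent (Path⇒≼ u→z) u≢z) (deepest (forwards a⇠z , z→b))
      where
      u≢z : u ≢ z
      u≢z refl = Unique[x∷xs]⇒x∉xs down-unique z∈down
    j∉ : j ∉ vertices up ++ targets u→b
    j∉ j∈ with ∈-++⁻ (vertices up) j∈
    ... | inj₁ j∈up   = acyclic _ _ a→j (forwards (proj₁ (∈-vertices up j∈up)))
    ... | inj₂ j∈down = acyclic _ _ b→j (proj₂ (∈-vertices u→b (there j∈down)))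
    simple : Unique (vertices (inj₂ a→j ◅ walk))
    simple = subst (λ vs → Unique (j ∷ a ∷ vs)) (sym walk-targets)
      (¬Any⇒All¬ _ j∉ ∷ Unique.++⁺ (vertices-unique (λ e p → acyclic _ _ e (forwards p)) up)
                                   (AllPairs.tail down-unique) disjoint)

  covers⇒edge : ∀ {i j} → Covers A i j → G i j
  covers⇒edge {i} {j} (i≼j , i≢j , no-middle) with ≼⇒Path i≼j
  ... | ε = contradiction refl i≢j
  ... | _◅_ {j = x} i→x x→j with x ≟F j
  ...   | yes refl = i→x
  ...   | no  x≢j  =
    contradiction (x , loop-free i→x ∘ sym , x≢j , Path⇒≼ (i→x ◅ ε) , Path⇒≼ x→j) no-middle

  poset-compatible : PosetCompatible A
  poset-compatible i j Aij≢0 with unimodular i j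
  ... | inj₁ Aij≡0 = contradiction Aij≡0 Aij≢0
  ... | inj₂ Aij≡1 = Path⇒≼ (one⇒Path Aij≡1)

  columns : ColumnsAtMostOneNonzero (B A)
  columns j i i′ Bij≢0 Bi′j≢0 =
    one-parent (covers⇒edge (B≢0⇒covers Bij≢0)) (covers⇒edge (B≢0⇒covers Bi′j≢0))

module HasseCone {n} {A : Matrix n} (unimodular : Unimodular A) (independent : LinIndep A)
                 (compatible : PosetCompatible A) (columns : ColumnsAtMostOneNonzero (B A)) where

  open UnimodularCone unimodular

  one-parent : AtMostOneParent (Covers A)
  one-parent {a} {b} {j} a⋖j b⋖j = columns j a b (covers⇒B≢0 a⋖j) (covers⇒B≢0 b⋖j)

  one⇒≼ : ∀ {i j} → A i j ≡ 1ℤ → i ≼[ A ] j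
  one⇒≼ {i} {j} Aij≡1 = compatible i j (λ Aij≡0 → 1≢0 (trans (sym Aij≡1) Aij≡0))

  -- If A_jj = 0 but the diagonal is 1 strictly above j, then row j is the sum of the rows of the
  -- minimal elements of its support, contradicting independence.
  module ZeroDiagonal {j} (Ajj≡0 : A j j ≡ 0ℤ)
                      (above-one : ∀ {l} → j ≼[ A ] l → l ≢ j → A l l ≡ 1ℤ) where

    Support : Fin n → Set
    Support l = A j l ≡ 1ℤ

    support⇒above : ∀ {l} → Support l → j ≼[ A ] l × l ≢ j
    support⇒above Ajl≡1 = one⇒≼ Ajl≡1 , λ { refl → 1≢0 (trans (sym Ajl≡1) Ajj≡0) }

    above⇒support : ∀ {l} → j ≼[ A ] l → l ≢ j → Support l
    above⇒support j≼l l≢j = ≼⇒ones-⊆ j≼l (above-one j≼l l≢j)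

    MinimalSupport : Fin n → Set
    MinimalSupport l = Support l × (∀ l′ → Support l′ → l′ ≼[ A ] l → l′ ≡ l)

    minimal-support? : ∀ l → Dec (MinimalSupport l)
    minimal-support? l =
      (A j l ℤ.≟ 1ℤ) ×-dec all? (λ l′ → (A j l′ ℤ.≟ 1ℤ) →-dec ≼? A l′ l →-dec l′ ≟F l)

    minimal-support-below : ∀ {k} → Support k → ∃[ m ] (MinimalSupport m × m ≼[ A ] k)
    minimal-support-below {k} Ajk≡1
      with minimiser (λ l → (A j l ℤ.≟ 1ℤ) ×-dec ≼? A l k) zeros (Ajk≡1 , ≼-refl {A = A})
    ... | m , (Ajm≡1 , m≼k) , least = m , (Ajm≡1 , minimal) , m≼k
      where
      minimal : ∀ l → Support l → l ≼[ A ] m → l ≡ m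
      minimal l Ajl≡1 l≼m with l ≟F m
      ... | yes l≡m = l≡m
      ... | no  l≢m =
        contradiction (least (Ajl≡1 , ≼-trans {A = A} l≼m m≼k))
                      (ℕ.<⇒≱ (≺⇒zeros-< independent l≼m l≢m))

    minimal-supports-below-equal : ∀ {m m′ k} → MinimalSupport m → MinimalSupport m′ →
                                   m ≼[ A ] k → m′ ≼[ A ] k → m ≡ m′
    minimal-supports-below-equal {m} {m′} (Ajm≡1 , m-min) (Ajm′≡1 , m′-min) m≼k m′≼k
      with ancestors-comparable one-parent (≼⇒covers* independent m≼k) (≼⇒covers* independent m′≼k)
    ... | inj₁ m⋖*m′ = m′-min m Ajm≡1 (covers*⇒≼ m⋖*m′)
    ... | inj₂ m′⋖*m = sym (m-min m′ Ajm′≡1 (covers*⇒≼ m′⋖*m))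

    coefficient : Fin n → ℤ
    coefficient l = signed (l ≟F j) (minimal-support? l)

    coefficient-j : coefficient j ≡ 1ℤ
    coefficient-j = signed-yes (j ≟F j) (minimal-support? j) refl

    coefficient-minimal : ∀ {m} → MinimalSupport m → coefficient m ≡ -1ℤ
    coefficient-minimal {m} min-m =
      signed-no-yes (m ≟F j) (minimal-support? m) (proj₂ (support⇒above (proj₁ min-m))) min-m

    term-vanishes : ∀ {k} l → (l ≡ j → A l k ≡ 0ℤ) → (MinimalSupport l → A l k ≡ 0ℤ) →
                    coefficient l * A l k ≡ 0ℤ
    term-vanishes {k} l at-j at-minimal with l ≟F j | minimal-support? l
    ... | yes l≡j | _           = cong (1ℤ *_) (at-j l≡j)
    ... | no  _   | yes min-l   = cong (-1ℤ *_) (at-minimal min-l)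
    ... | no  _   | no  _       = ℤ.*-zeroˡ (A l k)

    outside-support : ∀ {k l} → A j k ≡ 0ℤ → MinimalSupport l → A l k ≡ 0ℤ
    outside-support {k} {l} Ajk≡0 (Ajl≡1 , _) with unimodular l k | support⇒above Ajl≡1
    ... | inj₁ Alk≡0 | _           = Alk≡0
    ... | inj₂ Alk≡1 | j≼l , l≢j with k ≟F j
    ...   | yes refl = contradiction (≼-antisym independent (one⇒≼ Alk≡1) j≼l) l≢j
    ...   | no  k≢j  =
      contradiction (trans (sym (above⇒support (≼-trans {A = A} j≼l (one⇒≼ Alk≡1)) k≢j)) Ajk≡0) 1≢0

    other-minimal : ∀ {k l m} → MinimalSupport m → m ≼[ A ] k → MinimalSupport l → l ≢ m → A l k ≡ 0ℤ
    other-minimal {k} {l} min-m m≼k min-l l≢m with unimodular l k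
    ... | inj₁ Alk≡0 = Alk≡0
    ... | inj₂ Alk≡1 = contradiction (minimal-supports-below-equal min-l min-m (one⇒≼ Alk≡1) m≼k) l≢m

    dependence : ∀ k → Σℤ (λ l → coefficient l * A l k) ≡ 0ℤ
    dependence k with unimodular j k
    ... | inj₁ Ajk≡0 = Σℤ-zero (λ l → term-vanishes l (λ { refl → Ajk≡0 }) (outside-support Ajk≡0))
    ... | inj₂ Ajk≡1 with minimal-support-below Ajk≡1
    ...   | m , min-m , m≼k = begin
      Σℤ (λ l → coefficient l * A l k)
        ≡⟨ Σℤ-pair j m (m≢j ∘ sym) (λ l l≢j l≢m →
             term-vanishes l (λ l≡j → contradiction l≡j l≢j)
                             (λ min-l → other-minimal min-m m≼k min-l l≢m)) ⟩
      coefficient j * A j k + coefficient m * A m k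
        ≡⟨ cong₂ _+_ (cong₂ _*_ coefficient-j Ajk≡1) (cong₂ _*_ (coefficient-minimal min-m) Amk≡1) ⟩
      1ℤ * 1ℤ + -1ℤ * 1ℤ
        ≡⟨⟩
      0ℤ ∎
      where
      open ≡-Reasoning
      m≢j : m ≢ j
      m≢j = proj₂ (support⇒above (proj₁ min-m))
      Amk≡1 : A m k ≡ 1ℤ
      Amk≡1 = ≼⇒ones-⊆ m≼k (uncurry above-one (support⇒above Ajk≡1))

    impossible : ⊥
    impossible = 1≢0 (trans (sym coefficient-j) (independent coefficient dependence j))

  diagonal-one : ∀ j → A j j ≡ 1ℤ
  diagonal-one j with unimodular j j
  ... | inj₂ Ajj≡1 = Ajj≡1
  ... | inj₁ Ajj≡0 with minimiser (λ l → A l l ℤ.≟ 0ℤ) ones Ajj≡0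
  ...   | l , All≡0 , deepest = ⊥-elim (ZeroDiagonal.impossible All≡0 above-one)
    where
    above-one : ∀ {l′} → l ≼[ A ] l′ → l′ ≢ l → A l′ l′ ≡ 1ℤ
    above-one {l′} l≼l′ l′≢l with unimodular l′ l′
    ... | inj₂ Al′l′≡1 = Al′l′≡1
    ... | inj₁ Al′l′≡0 =
      contradiction (deepest Al′l′≡0) (ℕ.<⇒≱ (≺⇒ones-< independent l≼l′ (l′≢l ∘ sym)))

  isΦ : IsΦ (Covers A) A
  isΦ i j with unimodular i j
  ... | inj₂ Aij≡1 = inj₁ (≼⇒covers* independent (one⇒≼ Aij≡1) , Aij≡1)
  ... | inj₁ Aij≡0 =
    inj₂ ((λ i⋖*j → 1≢0 (trans (sym (≼⇒ones-⊆ (covers*⇒≼ i⋖*j) (diagonal-one j))) Aij≡0)) , Aij≡0)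

  acyclic : Acyclic (Covers A)
  acyclic i j (i≼j , i≢j , _) j⋖*i = i≢j (≼-antisym independent i≼j (covers*⇒≼ j⋖*i))

  rooted-forest : IsRootedForest (Covers A)
  rooted-forest = Φ-order.rooted-forest isΦ independent acyclic one-parent

tree-like⇒compatible : ∀ {n} {A : Matrix n} → LinIndep A → TreeLike A →
                       PosetCompatible A × ColumnsAtMostOneNonzero (B A)
tree-like⇒compatible independent (F , Φ) = poset-compatible , columns
  where open TreeLikeCone F Φ independent

compatible⇒Hasse-forest : ∀ {n} {A : Matrix n} → Unimodular A → LinIndep A →
                          PosetCompatible A × ColumnsAtMostOneNonzero (B A) →
                          IsRootedForest (HasseΨ A) × IsΦ (HasseΨ A) A
compatible⇒Hasse-forest unimodular independent (compatible , columns) = rooted-forest , isΦ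
  where open HasseCone unimodular independent compatible columns

tree-like⇒Hasse-forest : ∀ {n} {A : Matrix n} → Unimodular A → LinIndep A → TreeLike A →
                         IsRootedForest (HasseΨ A) × IsΦ (HasseΨ A) A
tree-like⇒Hasse-forest unimodular independent =
  compatible⇒Hasse-forest unimodular independent ∘ tree-like⇒compatible independent

mainTheorem11 :
    -- tree-like  ⇔  poset compatible and B_C has ≤ 1 nonzero entry per column
    (∀ (n : ℕ) (A : Matrix n) → Unimodular A → LinIndep A →
        (TreeLike A → PosetCompatible A × ColumnsAtMostOneNonzero (B A))
      × (PosetCompatible A × ColumnsAtMostOneNonzero (B A) → TreeLike A))
    -- ≼_{Φ(F)} is the ancestor order of F
    × (∀ (n : ℕ) (F : RootedForest n) (A : Matrix n) → IsΦ (E F) A →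
        ∀ (i j : Fin n) → (i ≼[ A ] j → Path (E F) i j) × (Path (E F) i j → i ≼[ A ] j))
    -- Φ(Ψ(C)) = C for tree-like C
    × (∀ (n : ℕ) (A : Matrix n) → Unimodular A → LinIndep A → TreeLike A →
        IsRootedForest (HasseΨ A) × IsΦ (HasseΨ A) A)
    -- decorated versions
    × (∀ (S : Set) (n : ℕ) (F : RootedForest n) (d : Fin n → S) (A : Matrix n) (s : Fin n → S) →
        IsΦ̄ (E F) d A s →
        (∀ (i j : Fin n) → (i ≼[ A ] j → Path (E F) i j) × (Path (E F) i j → i ≼[ A ] j))
        × (∀ (i : Fin n) → proj₂ (Ψ̄ A s) i ≡ d i))
    × (∀ (S : Set) (n : ℕ) (A : Matrix n) (s : Fin n → S) → Unimodular A → LinIndep A → TreeLike A →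
        IsRootedForest (proj₁ (Ψ̄ A s)) × IsΦ̄ (proj₁ (Ψ̄ A s)) (proj₂ (Ψ̄ A s)) A s)
mainTheorem11 =
    (λ n A unimodular independent →
        tree-like⇒compatible independent ,
        λ conditions → let forest , Φ = compatible⇒Hasse-forest unimodular independent conditions
                       in record { E = HasseΨ A ; isForest = forest } , Φ)
  , (λ n F A Φ → Φ-order.≼⇔Path Φ)
  , (λ n A → tree-like⇒Hasse-forest)
  , (λ S n F d A s (Φ , s≡d) → Φ-order.≼⇔Path Φ , s≡d)
  , (λ S n A s unimodular independent tree-like →
        let forest , Φ = tree-like⇒Hasse-forest unimodular independent tree-like
        in forest , Φ , λ i → refl)
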